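{- Let $G=(V,E)$ be a graph containing a maximal independent set $I$ for which there exists a constant $\alpha\geq 1$ such that, with $R:=V\setminus I$, (1) $d(v)\leq \alpha$ for every $v\in I$, and (2) $d(v)\geq \alpha+\frac{d_R(v)+1}{2}$ for every $v\in R$. Then $G$ fulfills the 1--2--3 Conjecture.
   Context: All graphs are finite and simple. An independent set $I$ is maximal if every vertex of $V\setminus I$ has a neighbour in $I$. $d(v)$ is the degree of $v$ in $G$, and for $S\subseteq V$, $d_S(v)$ is the number of neighbours of $v$ in $S$. For $\omega:E\to\{1,2,3\}$, the sum at $v$ is $s_\omega(v)=\sum_{e\ni v}\omega(e)$. A graph fulfills the 1--2--3 Conjecture if there exists $\omega:E\to\{1,2,3\}$ with $s_\omega(u)\neq s_\omega(v)$ for every edge $uv\in E$.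
   Formalization: The constant α is taken to be a rational number. -}

module Defs where

open import Data.Nat using (ℕ; zero; suc; _+_)
open import Data.Fin using (Fin)
open import Data.Bool using (Bool; true; false; _∧_; not; T)
open import Data.List using (List; map; filter; length)
open import Data.Nat.ListAction using (sum)
open import Data.Integer using (+_)
open import Data.Rational using (ℚ; _/_)
open import Data.Fin.Base using (toℕ)
open import Data.List using (allFin)
open import Relation.Binary.PropositionalEquality using (_≡_; _≢_)
open import Data.Product using (Σ; _×_)

record Graph (n : ℕ) : Set where
  field
    adj   : Fin n → Fin n → Bool
    sym   : ∀ u v → adj u v ≡ adj v u
    irrefl : ∀ v → adj v v ≡ false
open Graph public

Subset : ℕ → Set
Subset n = Fin n → Bool

degIn : ∀ {n} → Graph n → Subset n → Fin n → ℕ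
degIn {n} G S v = length (filter (λ u → T? (adj G v u ∧ S u)) (allFin n))
  where
    open import Relation.Nullary.Decidable using (Dec)
    open import Data.Bool.Properties using (T?)

deg : ∀ {n} → Graph n → Fin n → ℕ
deg G v = degIn G (λ _ → true) v

compl : ∀ {n} → Subset n → Subset n
compl S v = not (S v)

Independent : ∀ {n} → Graph n → Subset n → Set
Independent G I = ∀ u v → T (I u) → T (I v) → adj G u v ≡ false

MaximalIndependent : ∀ {n} → Graph n → Subset n → Set
MaximalIndependent {n} G I =
  Independent G I ×
  (∀ v → I v ≡ false → Σ (Fin n) λ u → T (I u) × adj G v u ≡ true)

-- An edge weighting ω : E → {1,2,3}, represented as a symmetric function on
-- pairs of vertices (only values on adjacent pairs matter); weight of edge uv
-- is 1 + toℕ (ω u v).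
Weighting : ℕ → Set
Weighting n = Fin n → Fin n → Fin 3

weight : ∀ {n} → Weighting n → Fin n → Fin n → ℕ
weight ω u v = suc (toℕ (ω u v))

SymWeighting : ∀ {n} → Weighting n → Set
SymWeighting ω = ∀ u v → ω u v ≡ ω v u

wsum : ∀ {n} → Graph n → Weighting n → Fin n → ℕ
wsum {n} G ω v = sum (map (λ u → if adj G v u then weight ω v u else 0) (allFin n))
  where open import Data.Bool using (if_then_else_)

Fulfills123 : ∀ {n} → Graph n → Set
Fulfills123 {n} G =
  Σ (Weighting n) λ ω → SymWeighting ω ×
    (∀ u v → adj G u v ≡ true → wsum G ω u ≢ wsum G ω v)

ℕ→ℚ : ℕ → ℚ
ℕ→ℚ k = (+ k) / 1

module Submission where

-- The weighting is built greedily. Start with weight 2 everywhere and give each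
-- v ∈ R a neighbour p(v) ∈ I (maximality). Edges at I only ever weigh 1 or 2, so
-- s(x) ≤ 2 d(x) for x ∈ I. The vertices are handled in index order; when v ∈ R
-- is reached all its edges still weigh 2, so s(v) = 2 d(v). For an earlier
-- R-neighbour u, re-weighting uv to 1 (resp. 3) and u p(u) from 1 to 2 (resp.
-- 2 to 1) keeps s(u) and moves s(v) down (resp. up) by one. Hence s(v) can be
-- set to any value of an interval of L + 1 numbers starting at
-- ≥ 2 d(v) - d_R(v), where L is the number of earlier R-neighbours. One of them
-- avoids the L sums of those neighbours (pigeonhole), and by the hypotheses it
-- exceeds 2 d(x) ≥ s(x) for every neighbour x ∈ I of v.

open import Defs renaming (sym to adj-sym)
open import Data.Nat as ℕ using (ℕ)
open import Data.Fin using (Fin)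
open import Data.Bool using (true; false; T)
open import Data.Product using (Σ; _×_; _,_; proj₁; proj₂)
open import Relation.Binary.PropositionalEquality

module FinSum where
  open import Data.Nat using (ℕ; zero; suc; _+_; _*_; _≤_; z≤n)
  open import Data.Nat.Properties using (+-*-semiring; +-mono-≤; +-comm; +-assoc; *-identityʳ; *-zeroʳ)
  open import Data.Nat.ListAction using () renaming (sum to listSum)
  open import Data.Fin using (Fin; zero; suc; punchIn)
  open import Data.Fin.Properties using (punchInᵢ≢i)
  open import Data.Bool using (Bool; true; false; if_then_else_)
  open import Data.Bool.Properties using (T?)
  open import Data.List using (map; filter; length; tabulate)
  open import Function using (_∘_)
  open import Algebra.Properties.Semiring.Sum +-*-semiring
    using (sum-cong-≗; sum-remove; *-distribˡ-sum) renaming (sum to ∑) public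

  ∑-mono : ∀ {n} {f g : Fin n → ℕ} → (∀ i → f i ≤ g i) → ∑ f ≤ ∑ g
  ∑-mono {zero}  f≤g = z≤n
  ∑-mono {suc n} f≤g = +-mono-≤ (f≤g zero) (∑-mono (f≤g ∘ suc))

  ∑-update : ∀ {n} (f g : Fin n → ℕ) b → (∀ i → i ≢ b → f i ≡ g i) →
             ∑ f + g b ≡ ∑ g + f b
  ∑-update {suc n} f g b agree = begin
    ∑ f + g b                 ≡⟨ cong (_+ g b) (sum-remove {i = b} f) ⟩
    f b + rest + g b          ≡⟨ +-assoc (f b) rest (g b) ⟩
    f b + (rest + g b)        ≡⟨ +-comm (f b) (rest + g b) ⟩
    rest + g b + f b          ≡⟨ cong (λ r → r + g b + f b) (sum-cong-≗ (λ j → agree _ (punchInᵢ≢i b j))) ⟩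
    rest′ + g b + f b         ≡⟨ cong (_+ f b) (+-comm rest′ (g b)) ⟩
    g b + rest′ + f b         ≡⟨ cong (_+ f b) (sum-remove {i = b} g) ⟨
    ∑ g + f b                 ∎
    where
    open ≡-Reasoning
    rest rest′ : ℕ
    rest  = ∑ (f ∘ punchIn b)
    rest′ = ∑ (g ∘ punchIn b)

  𝟙 : Bool → ℕ
  𝟙 b = if b then 1 else 0

  ∑-const : ∀ {n} (P : Fin n → Bool) c → ∑ (λ i → if P i then c else 0) ≡ c * ∑ (𝟙 ∘ P)
  ∑-const P c = trans (sum-cong-≗ c·𝟙) (sym (*-distribˡ-sum c (𝟙 ∘ P)))
    where
    c·𝟙 : ∀ i → (if P i then c else 0) ≡ c * 𝟙 (P i)
    c·𝟙 i with P i
    ... | true  = sym (*-identityʳ c)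
    ... | false = sym (*-zeroʳ c)

  listSum-tabulate : ∀ {n} {A : Set} (h : A → ℕ) (f : Fin n → A) →
                     listSum (map h (tabulate f)) ≡ ∑ (h ∘ f)
  listSum-tabulate {zero}  h f = refl
  listSum-tabulate {suc n} h f = cong (h (f zero) +_) (listSum-tabulate h (f ∘ suc))

  length-filter-tabulate : ∀ {n} {A : Set} (P : A → Bool) (f : Fin n → A) →
                           length (filter (T? ∘ P) (tabulate f)) ≡ ∑ (𝟙 ∘ P ∘ f)
  length-filter-tabulate {zero}  P f = refl
  length-filter-tabulate {suc n} P f with P (f zero)
  ... | true  = cong suc (length-filter-tabulate P (f ∘ suc))
  ... | false = length-filter-tabulate P (f ∘ suc)

module Pigeonhole where
  open import Data.Nat using (ℕ; zero; suc; _+_; _≤_; _<_; _≟_)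
  open import Data.Nat.Properties using (≤-refl; ≤-trans; ≤-pred; <⇒≤; <⇒≢; m≤m+n; +-suc)
  open import Data.List using (List; []; length; filter)
  open import Data.List.Properties using (filter-notAll)
  open import Data.List.Membership.Propositional using (_∈_; _∉_)
  open import Data.List.Membership.DecPropositional _≟_ using (_∈?_)
  open import Data.List.Membership.Propositional.Properties using (∈-filter⁺)
  import Data.List.Relation.Unary.Any as Any
  open import Data.Product using (Σ-syntax; _×_; _,_)
  open import Relation.Nullary using (yes; no; ¬?)

  avoid : ∀ m (xs : List ℕ) → length xs ≤ m → ∀ b → Σ[ t ∈ ℕ ] b ≤ t × t ≤ b + m × t ∉ xs
  avoid m xs _ b with b ∈? xs
  ... | no b∉xs = b , ≤-refl , m≤m+n b m , b∉xs
  avoid zero [] _ b | yes ()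
  avoid (suc m) xs |xs|≤1+m b | yes b∈xs with avoid m ys |ys|≤m (suc b)
    where
    -- Drop every copy of b; at least one element disappears.
    ys = filter (λ x → ¬? (x ≟ b)) xs
    |ys|≤m : length ys ≤ m
    |ys|≤m = ≤-pred (≤-trans (filter-notAll _ xs (Any.map (λ x≡b x≢b → x≢b (sym x≡b)) b∈xs)) |xs|≤1+m)
  ... | t , b<t , t≤1+b+m , t∉ys =
    t , <⇒≤ b<t , subst (t ≤_) (sym (+-suc b m)) t≤1+b+m ,
    λ t∈xs → t∉ys (∈-filter⁺ (λ x → ¬? (x ≟ b)) t∈xs (λ t≡b → <⇒≢ b<t (sym t≡b)))

module NatEmbedding where
  open import Data.Nat.Coprimality using (1-coprimeTo) renaming (sym to coprime-sym)
  open import Data.Integer as ℤ using (+_)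
  open import Data.Integer.Properties as ℤ using (pos-+; pos-*; drop‿+≤+)
  open import Data.Rational using (ℚ; mkℚ; _≤_; _+_; _*_; _/_; 1ℚ; *≤*)
  open import Data.Rational.Properties as ℚ using (normalize-coprime)

  ℕ→ℚ-canonical : ∀ k → ℕ→ℚ k ≡ mkℚ (+ k) 0 (coprime-sym (1-coprimeTo k))
  ℕ→ℚ-canonical k = normalize-coprime (coprime-sym (1-coprimeTo k))

  ℕ→ℚ-+ : ∀ m n → ℕ→ℚ m + ℕ→ℚ n ≡ ℕ→ℚ (m ℕ.+ n)
  ℕ→ℚ-+ m n = begin
    ℕ→ℚ m + ℕ→ℚ n                         ≡⟨ cong₂ _+_ (ℕ→ℚ-canonical m) (ℕ→ℚ-canonical n) ⟩
    (+ m ℤ.* + 1 ℤ.+ + n ℤ.* + 1) / 1     ≡⟨ cong (_/ 1) (cong₂ ℤ._+_ (ℤ.*-identityʳ (+ m))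
                                                                      (ℤ.*-identityʳ (+ n))) ⟩
    (+ m ℤ.+ + n) / 1                     ≡⟨ cong (_/ 1) (pos-+ m n) ⟨
    ℕ→ℚ (m ℕ.+ n)                         ∎
    where open ≡-Reasoning

  ℕ→ℚ-* : ∀ m n → ℕ→ℚ m * ℕ→ℚ n ≡ ℕ→ℚ (m ℕ.* n)
  ℕ→ℚ-* m n = trans (cong₂ _*_ (ℕ→ℚ-canonical m) (ℕ→ℚ-canonical n)) (cong (_/ 1) (sym (pos-* m n)))

  ℕ→ℚ-cancel-≤ : ∀ {m n} → ℕ→ℚ m ≤ ℕ→ℚ n → m ℕ.≤ n
  ℕ→ℚ-cancel-≤ {m} {n} le with subst₂ _≤_ (ℕ→ℚ-canonical m) (ℕ→ℚ-canonical n) le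
  ... | *≤* m·1≤n·1 = drop‿+≤+ (subst₂ ℤ._≤_ (ℤ.*-identityʳ (+ m)) (ℤ.*-identityʳ (+ n)) m·1≤n·1)

  combine-degree-bounds : ∀ a b c (α : ℚ) → ℕ→ℚ a ≤ α →
                          ℕ→ℚ 2 * α + ℕ→ℚ b + 1ℚ ≤ ℕ→ℚ 2 * ℕ→ℚ c →
                          2 ℕ.* a ℕ.+ b ℕ.+ 1 ℕ.≤ 2 ℕ.* c
  combine-degree-bounds a b c α a≤α bound = ℕ→ℚ-cancel-≤ (subst₂ _≤_ lhs (ℕ→ℚ-* 2 c) bound′)
    where
    bound′ : ℕ→ℚ 2 * ℕ→ℚ a + ℕ→ℚ b + 1ℚ ≤ ℕ→ℚ 2 * ℕ→ℚ c
    bound′ = ℚ.≤-trans (ℚ.+-monoˡ-≤ 1ℚ (ℚ.+-monoˡ-≤ (ℕ→ℚ b) (ℚ.*-monoˡ-≤-nonNeg (ℕ→ℚ 2) a≤α))) bound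
    lhs : ℕ→ℚ 2 * ℕ→ℚ a + ℕ→ℚ b + 1ℚ ≡ ℕ→ℚ (2 ℕ.* a ℕ.+ b ℕ.+ 1)
    lhs = begin
      ℕ→ℚ 2 * ℕ→ℚ a + ℕ→ℚ b + 1ℚ         ≡⟨ cong (λ q → q + ℕ→ℚ b + 1ℚ) (ℕ→ℚ-* 2 a) ⟩
      ℕ→ℚ (2 ℕ.* a) + ℕ→ℚ b + 1ℚ         ≡⟨ cong (_+ 1ℚ) (ℕ→ℚ-+ (2 ℕ.* a) b) ⟩
      ℕ→ℚ (2 ℕ.* a ℕ.+ b) + ℕ→ℚ 1        ≡⟨ ℕ→ℚ-+ (2 ℕ.* a ℕ.+ b) 1 ⟩
      ℕ→ℚ (2 ℕ.* a ℕ.+ b ℕ.+ 1)          ∎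
      where open ≡-Reasoning

module Weights where
  open FinSum
  open import Data.Nat using (ℕ; zero; suc; _+_; _*_; _≤_; z≤n; s≤s)
  open import Data.Nat.Properties using (module ≤-Reasoning)
  open import Data.Fin using (Fin; zero; suc; toℕ)
  open import Data.Fin.Properties using (_≟_)
  open import Data.Bool using (true; false; if_then_else_; _∧_)
  open import Data.Bool.Properties using (∧-identityʳ)
  open import Data.Product using (_×_; _,_)
  open import Data.Sum using (_⊎_; inj₁; inj₂)
  open import Data.Empty using (⊥-elim)
  open import Relation.Nullary using (¬_; Dec; yes; no)
  open import Relation.Nullary.Decidable using (_×-dec_; _⊎-dec_)
  open import Function using (_∘_)

  -- ℕ-valued weightings of ordered vertex pairs; only symmetric ones are used.
  Weights : ℕ → Set
  Weights n = Fin n → Fin n → ℕ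

  module _ {n : ℕ} where

    SamePair : (a b x y : Fin n) → Set
    SamePair a b x y = (x ≡ a × y ≡ b) ⊎ (x ≡ b × y ≡ a)

    samePair? : ∀ a b x y → Dec (SamePair a b x y)
    samePair? a b x y = ((x ≟ a) ×-dec (y ≟ b)) ⊎-dec ((x ≟ b) ×-dec (y ≟ a))

    samePair-sym : ∀ {a b x y} → SamePair a b x y → SamePair a b y x
    samePair-sym (inj₁ (x≡a , y≡b)) = inj₂ (y≡b , x≡a)
    samePair-sym (inj₂ (x≡b , y≡a)) = inj₁ (y≡a , x≡b)

    samePair-partner : ∀ {a b x y z} → SamePair a b x y → SamePair a b x z → z ≡ y
    samePair-partner (inj₁ (_ , refl))    (inj₁ (_ , refl))    = refl
    samePair-partner (inj₁ (refl , refl)) (inj₂ (x≡b , refl))  = x≡b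
    samePair-partner (inj₂ (refl , refl)) (inj₁ (x≡a , refl))  = x≡a
    samePair-partner (inj₂ (_ , refl))    (inj₂ (_ , refl))    = refl

    -- ω with the weight of the unordered pair {a, b} set to c. It is opaque, so
    -- that it is only ever used through setPair-on and setPair-off.
    opaque
      setPair : Weights n → (a b : Fin n) → ℕ → Weights n
      setPair ω a b c x y with samePair? a b x y
      ... | yes _ = c
      ... | no  _ = ω x y

      setPair-on : ∀ {ω a b c x y} → SamePair a b x y → setPair ω a b c x y ≡ c
      setPair-on {a = a} {b} {x = x} {y} same with samePair? a b x y
      ... | yes _    = refl
      ... | no ¬same = ⊥-elim (¬same same)

      setPair-off : ∀ {ω a b c x y} → ¬ SamePair a b x y → setPair ω a b c x y ≡ ω x y
      setPair-off {a = a} {b} {x = x} {y} ¬same with samePair? a b x y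
      ... | yes same = ⊥-elim (¬same same)
      ... | no _     = refl

    module _ {ω : Weights n} {a b : Fin n} {c : ℕ} where

      setPair-far : ∀ {x y} → x ≢ a → x ≢ b → setPair ω a b c x y ≡ ω x y
      setPair-far x≢a x≢b = setPair-off λ { (inj₁ (x≡a , _)) → x≢a x≡a ; (inj₂ (x≡b , _)) → x≢b x≡b }

      setPair-preserves : ∀ (P : ℕ → Set) {x y} → P c → P (ω x y) → P (setPair ω a b c x y)
      setPair-preserves P {x} {y} Pc Pω with samePair? a b x y
      ... | yes same = subst P (sym (setPair-on same)) Pc
      ... | no ¬same = subst P (sym (setPair-off ¬same)) Pω

      setPair-sym : (∀ x y → ω x y ≡ ω y x) → ∀ x y → setPair ω a b c x y ≡ setPair ω a b c y x
      setPair-sym ω-sym x y with samePair? a b x y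
      ... | yes same = trans (setPair-on same) (sym (setPair-on (samePair-sym same)))
      ... | no ¬same = trans (setPair-off ¬same)
                         (trans (ω-sym x y) (sym (setPair-off (¬same ∘ samePair-sym))))

  module WeightedDegree {n} (G : Graph n) where

    ws : Weights n → Fin n → ℕ
    ws ω v = ∑ (λ u → if adj G v u then ω v u else 0)

    deg-∑ : ∀ v → deg G v ≡ ∑ (𝟙 ∘ adj G v)
    deg-∑ v = trans (length-filter-tabulate (λ u → adj G v u ∧ true) (λ u → u))
                    (sum-cong-≗ (λ u → cong 𝟙 (∧-identityʳ (adj G v u))))

    ws-≤ : ∀ {ω x c} → (∀ y → adj G x y ≡ true → ω x y ≤ c) → ws ω x ≤ c * deg G x
    ws-≤ {ω} {x} {c} bounded = begin
      ws ω x                                   ≤⟨ ∑-mono pointwise ⟩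
      ∑ (λ u → if adj G x u then c else 0)     ≡⟨ ∑-const (adj G x) c ⟩
      c * ∑ (𝟙 ∘ adj G x)                      ≡⟨ cong (c *_) (deg-∑ x) ⟨
      c * deg G x                              ∎
      where
      open ≤-Reasoning
      pointwise : ∀ u → (if adj G x u then ω x u else 0) ≤ (if adj G x u then c else 0)
      pointwise u with adj G x u in xu
      ... | true  = bounded u xu
      ... | false = z≤n

    ws-≡ : ∀ {ω x c} → (∀ y → adj G x y ≡ true → ω x y ≡ c) → ws ω x ≡ c * deg G x
    ws-≡ {ω} {x} {c} constant =
      trans (sum-cong-≗ pointwise) (trans (∑-const (adj G x) c) (cong (c *_) (sym (deg-∑ x))))
      where
      pointwise : ∀ u → (if adj G x u then ω x u else 0) ≡ (if adj G x u then c else 0)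
      pointwise u with adj G x u in xu
      ... | true  = constant u xu
      ... | false = refl

    ws-setPair-end : ∀ {ω a b c x y} → SamePair a b x y → adj G x y ≡ true →
                     ws (setPair ω a b c) x + ω x y ≡ ws ω x + c
    ws-setPair-end {ω} {a} {b} {c} {x} {y} same xy = begin
      ws ω′ x + ω x y      ≡⟨ cong (ws ω′ x +_) (sym (at-y (ω x y))) ⟩
      ws ω′ x + summand y  ≡⟨ ∑-update summand′ summand y agree ⟩
      ws ω x + summand′ y  ≡⟨ cong (ws ω x +_) (trans (at-y _) (setPair-on same)) ⟩
      ws ω x + c           ∎
      where
      open ≡-Reasoning
      ω′ : Weights n
      ω′ = setPair ω a b c
      summand summand′ : Fin n → ℕ
      summand  u = if adj G x u then ω x u else 0
      summand′ u = if adj G x u then ω′ x u else 0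
      at-y : ∀ w → (if adj G x y then w else 0) ≡ w
      at-y w rewrite xy = refl
      agree : ∀ u → u ≢ y → summand′ u ≡ summand u
      agree u u≢y = cong (if adj G x u then_else 0)
                         (setPair-off (λ same′ → u≢y (samePair-partner same same′)))

    ws-setPair-far : ∀ {ω a b c x} → x ≢ a → x ≢ b → ws (setPair ω a b c) x ≡ ws ω x
    ws-setPair-far {ω} {a} {b} {c} {x} x≢a x≢b =
      sum-cong-≗ (λ u → cong (if adj G x u then_else 0) (setPair-far {ω = ω} {a = a} {b = b} {c = c} x≢a x≢b))

    weight-of : ℕ → Fin 3
    weight-of 2 = suc zero
    weight-of 3 = suc (suc zero)
    weight-of _ = zero

    weight-of-correct : ∀ {w} → 1 ≤ w → w ≤ 3 → suc (toℕ (weight-of w)) ≡ w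
    weight-of-correct {1} _ _ = refl
    weight-of-correct {2} _ _ = refl
    weight-of-correct {3} _ _ = refl
    weight-of-correct {suc (suc (suc (suc w)))} _ (s≤s (s≤s (s≤s ())))

    fulfills-123 : (ω : Weights n) → (∀ x y → ω x y ≡ ω y x) →
                   (∀ x y → adj G x y ≡ true → 1 ≤ ω x y) → (∀ x y → adj G x y ≡ true → ω x y ≤ 3) →
                   (∀ x y → adj G x y ≡ true → ws ω x ≢ ws ω y) → Fulfills123 G
    fulfills-123 ω symmetric ≥1 ≤3 proper =
      ω₃ , (λ x y → cong weight-of (symmetric x y)) ,
      λ x y xy → subst₂ _≢_ (sym (wsum≡ws x)) (sym (wsum≡ws y)) (proper x y xy)
      where
      ω₃ : Weighting n
      ω₃ x y = weight-of (ω x y)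
      wsum≡ws : ∀ x → wsum G ω₃ x ≡ ws ω x
      wsum≡ws x = trans (listSum-tabulate (λ y → if adj G x y then weight ω₃ x y else 0) (λ y → y))
                        (sum-cong-≗ same-summand)
        where
        same-summand : ∀ y → (if adj G x y then weight ω₃ x y else 0) ≡ (if adj G x y then ω x y else 0)
        same-summand y with adj G x y in xy
        ... | true  = weight-of-correct (≥1 x y xy) (≤3 x y xy)
        ... | false = refl

module Greedy {n} (G : Graph n) (I : Subset n)
  (p : Fin n → Fin n)
  (p∈I : ∀ u → I u ≡ false → I (p u) ≡ true)
  (u~p : ∀ u → I u ≡ false → adj G u (p u) ≡ true)
  (independent : ∀ x y → I x ≡ true → I y ≡ true → adj G x y ≡ false)
  (degree-gap : ∀ x v → I x ≡ true → I v ≡ false → adj G v x ≡ true →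
                2 ℕ.* deg G x ℕ.+ degIn G (compl I) v ℕ.+ 1 ℕ.≤ 2 ℕ.* deg G v) where

  open import Data.Nat using (zero; suc; _+_; _*_; _∸_; _≤_; _<_; _≤?_; _<?_; z≤n; s≤s)
  open import Data.Fin using (toℕ; fromℕ<)
  open import Data.Fin.Properties using (toℕ-fromℕ<; toℕ-injective; toℕ<n)
  open import Data.Bool using (true; false; not; _∧_)
  open import Data.Nat.Properties
  open import Data.Product using (Σ; _×_; _,_; proj₁; proj₂)
  open import Data.Sum using (_⊎_; inj₁; inj₂)
  open import Data.Empty using (⊥-elim)
  open import Data.List using (List; []; _∷_; length; filter; map; allFin)
  open import Data.List.Properties using (length-filter; length-map)
  open import Data.List.Membership.Propositional using (_∈_; _∉_)
  open import Data.List.Membership.Propositional.Properties using (∈-filter⁺; ∈-filter⁻; ∈-allFin; ∈-map⁺)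
  import Data.List.Relation.Unary.Unique.Propositional.Properties as Unique
  open import Data.Bool.Properties using (T?; T-≡; T-∧; T-not-≡)
  open import Function.Bundles using (Equivalence)
  open import Data.List.Relation.Unary.All as All using (All; []; _∷_)
  open import Data.List.Relation.Unary.Unique.Propositional using (Unique)
  open import Data.List.Relation.Unary.AllPairs using (_∷_)
  open import Relation.Nullary using (Dec; yes; no)
  open import Function using (_∘_)
  open Pigeonhole
  open Weights
  open WeightedDegree G

  true≢false : true ≢ false
  true≢false ()

  I≢R : ∀ {x y} → I x ≡ true → I y ≡ false → x ≢ y
  I≢R x∈I y∈R refl = true≢false (trans (sym x∈I) y∈R)

  adj⇒≢ : ∀ {x y} → adj G x y ≡ true → x ≢ y
  adj⇒≢ {x} xy refl = true≢false (trans (sym xy) (irrefl G x))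

  R≢p : ∀ {u x} → I u ≡ false → I x ≡ false → x ≢ p u
  R≢p u∈R x∈R x≡pu = I≢R (p∈I _ u∈R) x∈R (sym x≡pu)

  below⇒≢ : ∀ {K} {x y : Fin n} → toℕ y < K → K ≤ toℕ x → x ≢ y
  below⇒≢ y<K K≤x refl = <⇒≱ y<K K≤x

  -- The invariant on the weighting after the R-vertices of index < K have been
  -- handled: symmetric, edge weights in {1,2,3}, weights at most 2 on edges at I,
  -- and weight 2 on every edge at an R-vertex not yet handled.
  record Admissible (K : ℕ) (ω : Weights n) : Set where
    field
      symmetric  : ∀ x y → ω x y ≡ ω y x
      ≥1         : ∀ x y → adj G x y ≡ true → 1 ≤ ω x y
      ≤3         : ∀ x y → adj G x y ≡ true → ω x y ≤ 3
      light-at-I : ∀ x y → I x ≡ true → adj G x y ≡ true → ω x y ≤ 2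
      fresh      : ∀ x y → I x ≡ false → K ≤ toℕ x → adj G x y ≡ true → ω x y ≡ 2
  open Admissible

  admissible-suc : ∀ {K ω} → Admissible K ω → Admissible (suc K) ω
  admissible-suc A = record
    { symmetric = symmetric A ; ≥1 = ≥1 A ; ≤3 = ≤3 A ; light-at-I = light-at-I A
    ; fresh = λ x y x∈R K<x → fresh A x y x∈R (≤-trans (n≤1+n _) K<x) }

  ≥1-at-p : ∀ {K ω} → Admissible K ω → ∀ u → I u ≡ false → 1 ≤ ω u (p u)
  ≥1-at-p A u u∈R = ≥1 A u (p u) (u~p u u∈R)

  ≤2-at-p : ∀ {K ω} → Admissible K ω → ∀ u → I u ≡ false → ω u (p u) ≤ 2
  ≤2-at-p A u u∈R = subst (_≤ 2) (symmetric A (p u) u)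
    (light-at-I A (p u) u (p∈I u u∈R) (trans (adj-sym G (p u) u) (u~p u u∈R)))

  record Step (K : ℕ) (v u : Fin n) (ω : Weights n) : Set where
    field
      ω′          : Weights n
      admissible′ : Admissible K ω′
      frame       : ∀ x y → x ≢ u → x ≢ v → x ≢ p u → ω′ x y ≡ ω x y
      keeps-R     : ∀ x → I x ≡ false → x ≢ v → ws ω′ x ≡ ws ω x

  no-step : ∀ {K v u ω} → Admissible K ω → Step K v u ω
  no-step {ω = ω} A = record
    { ω′ = ω ; admissible′ = A ; frame = λ _ _ _ _ _ → refl ; keeps-R = λ _ _ _ → refl }

  -- Cancellation used for the sum at u in a shift.
  shift-balance : ∀ A B C w c₁ c₂ → A + w ≡ B + c₂ → B + 2 ≡ C + c₁ → c₁ + c₂ ≡ 2 + w → A ≡ C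
  shift-balance A B C w c₁ c₂ e₁ e₂ e₃ = +-cancelʳ-≡ (w + 2) A C (begin
    A + (w + 2)      ≡⟨ +-assoc A w 2 ⟨
    A + w + 2        ≡⟨ cong (_+ 2) e₁ ⟩
    B + c₂ + 2       ≡⟨ +-assoc B c₂ 2 ⟩
    B + (c₂ + 2)     ≡⟨ cong (B +_) (+-comm c₂ 2) ⟩
    B + (2 + c₂)     ≡⟨ +-assoc B 2 c₂ ⟨
    B + 2 + c₂       ≡⟨ cong (_+ c₂) e₂ ⟩
    C + c₁ + c₂      ≡⟨ +-assoc C c₁ c₂ ⟩
    C + (c₁ + c₂)    ≡⟨ cong (C +_) (trans e₃ (+-comm 2 w)) ⟩
    C + (w + 2)      ∎)
    where open ≡-Reasoning

  -- For an R-edge uv of weight 2, put c₁ on uv and c₂ on u p(u),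
  -- where c₁ + c₂ = 2 + ω(u p(u)). Then s(u) is unchanged, s(v) changes by c₁ - 2,
  -- and besides u and v only s(p(u)) (a vertex of I) can change.
  module Shift {K ω} (A : Admissible K ω) {u v} (u∈R : I u ≡ false) (v∈R : I v ≡ false)
               (u~v : adj G u v ≡ true) (u<K : toℕ u < K) (v<K : toℕ v < K) (uv≡2 : ω u v ≡ 2)
               (c₁ c₂ : ℕ) (balance : c₁ + c₂ ≡ 2 + ω u (p u))
               (1≤c₁ : 1 ≤ c₁) (c₁≤3 : c₁ ≤ 3) (1≤c₂ : 1 ≤ c₂) (c₂≤2 : c₂ ≤ 2) where

    ω-uv : Weights n
    ω-uv = setPair ω u v c₁

    ω′ : Weights n
    ω′ = setPair ω-uv u (p u) c₂

    private
      u≢v : u ≢ v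
      u≢v = adj⇒≢ u~v
      pu≢v : p u ≢ v
      pu≢v = I≢R (p∈I u u∈R) v∈R
      up-unchanged : ω-uv u (p u) ≡ ω u (p u)
      up-unchanged = setPair-off (λ same → pu≢v (samePair-partner (inj₁ (refl , refl)) same))

    frame : ∀ x y → x ≢ u → x ≢ v → x ≢ p u → ω′ x y ≡ ω x y
    frame x y x≢u x≢v x≢pu = trans (setPair-far x≢u x≢pu) (setPair-far x≢u x≢v)

    admissible′ : Admissible K ω′
    admissible′ = record
      { symmetric  = setPair-sym (setPair-sym (symmetric A))
      ; ≥1         = λ x y xy → setPair-preserves (1 ≤_) 1≤c₂ (setPair-preserves (1 ≤_) 1≤c₁ (≥1 A x y xy))
      ; ≤3         = λ x y xy → setPair-preserves (_≤ 3) (≤-trans c₂≤2 (n≤1+n 2))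
                                  (setPair-preserves (_≤ 3) c₁≤3 (≤3 A x y xy))
      ; light-at-I = λ x y x∈I xy → setPair-preserves (_≤ 2) c₂≤2
                                      (subst (_≤ 2) (sym (setPair-far (I≢R x∈I u∈R) (I≢R x∈I v∈R)))
                                        (light-at-I A x y x∈I xy))
      ; fresh      = λ x y x∈R K≤x xy → trans (frame x y (below⇒≢ u<K K≤x) (below⇒≢ v<K K≤x) (R≢p u∈R x∈R))
                                              (fresh A x y x∈R K≤x xy) }

    sum-at-v : ws ω′ v + 2 ≡ ws ω v + c₁
    sum-at-v = begin
      ws ω′ v + 2         ≡⟨ cong (_+ 2) (ws-setPair-far (≢-sym u≢v) (≢-sym pu≢v)) ⟩
      ws ω-uv v + 2       ≡⟨ cong (ws ω-uv v +_) (trans (sym uv≡2) (symmetric A u v)) ⟩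
      ws ω-uv v + ω v u   ≡⟨ ws-setPair-end (inj₂ (refl , refl)) (trans (adj-sym G v u) u~v) ⟩
      ws ω v + c₁         ∎
      where open ≡-Reasoning

    sum-at-u : ws ω′ u ≡ ws ω u
    sum-at-u = shift-balance (ws ω′ u) (ws ω-uv u) (ws ω u) (ω u (p u)) c₁ c₂
      (trans (cong (ws ω′ u +_) (sym up-unchanged))
             (ws-setPair-end (inj₁ (refl , refl)) (u~p u u∈R)))
      (trans (cong (ws ω-uv u +_) (sym uv≡2)) (ws-setPair-end (inj₁ (refl , refl)) u~v))
      balance

    keeps-R : ∀ x → I x ≡ false → x ≢ v → ws ω′ x ≡ ws ω x
    keeps-R x x∈R x≢v = by-cases (x Data.Fin.≟ u)
      where
      by-cases : Dec (x ≡ u) → ws ω′ x ≡ ws ω x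
      by-cases (yes x≡u) = subst (λ z → ws ω′ z ≡ ws ω z) (sym x≡u) sum-at-u
      by-cases (no x≢u)  = trans (ws-setPair-far x≢u (R≢p u∈R x∈R)) (ws-setPair-far x≢u x≢v)

    step : Step K v u ω
    step = record { ω′ = ω′ ; admissible′ = admissible′ ; frame = frame ; keeps-R = keeps-R }

  -- An edge u p(u) of weight 1 lets the sum at a neighbour of u drop by one
  -- (weight 2 lets it rise by one); drops and rises count these options in a list.
  can-drop can-rise : ℕ → ℕ
  can-drop 1 = 1
  can-drop _ = 0
  can-rise 1 = 0
  can-rise _ = 1

  drops rises : Weights n → List (Fin n) → ℕ
  drops ω []       = 0
  drops ω (u ∷ us) = can-drop (ω u (p u)) + drops ω us
  rises ω []       = 0
  rises ω (u ∷ us) = can-rise (ω u (p u)) + rises ω us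

  drops+rises : ∀ ω us → drops ω us + rises ω us ≡ length us
  drops+rises ω []       = refl
  drops+rises ω (u ∷ us) = trans (one-option (ω u (p u)) (drops ω us) (rises ω us))
                                 (cong suc (drops+rises ω us))
    where
    one-option : ∀ w d r → can-drop w + d + (can-rise w + r) ≡ suc (d + r)
    one-option 1               d r = refl
    one-option 0               d r = +-suc d r
    one-option (suc (suc w))   d r = +-suc d r

  Unchanged-on : Weights n → Weights n → List (Fin n) → Set
  Unchanged-on ω′ ω us = All (λ u → ∀ y → ω′ u y ≡ ω u y) us

  drops-cong : ∀ {ω′ ω} us → Unchanged-on ω′ ω us → drops ω′ us ≡ drops ω us
  drops-cong []       []       = refl
  drops-cong (u ∷ us) (e ∷ es) = cong₂ _+_ (cong can-drop (e (p u))) (drops-cong us es)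

  rises-cong : ∀ {ω′ ω} us → Unchanged-on ω′ ω us → rises ω′ us ≡ rises ω us
  rises-cong []       []       = refl
  rises-cong (u ∷ us) (e ∷ es) = cong₂ _+_ (cong can-rise (e (p u))) (rises-cong us es)

  module Reach (K : ℕ) {v : Fin n} (v∈R : I v ≡ false) (v<K : toℕ v < K) where

    Earlier : Fin n → Set
    Earlier u = I u ≡ false × adj G u v ≡ true × toℕ u < K

    record Realises (ω : Weights n) (T : ℕ) : Set where
      field
        ω′            : Weights n
        ω′-admissible : Admissible K ω′
        ω′-at-v       : ws ω′ v ≡ T
        ω′-keeps-R    : ∀ x → I x ≡ false → x ≢ v → ws ω′ x ≡ ws ω x

    -- Every target between s(v) - drops and s(v) + rises is realisable, using each
    -- earlier neighbour u (with uv still of weight 2) for at most one shift.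
    reach : ∀ us → Unique us → All Earlier us → ∀ {ω} → Admissible K ω → All (λ u → ω u v ≡ 2) us →
            ∀ T → ws ω v ≤ T + drops ω us → T ≤ ws ω v + rises ω us → Realises ω T
    reach [] _ _ {ω} A _ T lo hi = record
      { ω′ = ω ; ω′-admissible = A ; ω′-keeps-R = λ _ _ _ → refl
      ; ω′-at-v = ≤-antisym (subst (ws ω v ≤_) (+-identityʳ T) lo) (subst (T ≤_) (+-identityʳ _) hi) }
    reach (u ∷ us) (u∉us ∷ unique) ((u∈R , u~v , u<K) ∷ earlier-us) {ω} A (uv≡2 ∷ tail≡2) T lo hi =
      by-weight (ω u (p u)) refl lo hi
      where
      continue : (S : Step K v u ω) → ws (Step.ω′ S) v ≤ T + drops ω us →
                 T ≤ ws (Step.ω′ S) v + rises ω us → Realises ω T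
      continue S lo′ hi′ = record
        { ω′ = Realises.ω′ rest ; ω′-admissible = Realises.ω′-admissible rest ; ω′-at-v = Realises.ω′-at-v rest
        ; ω′-keeps-R = λ x x∈R x≢v → trans (Realises.ω′-keeps-R rest x x∈R x≢v) (keeps-R x x∈R x≢v) }
        where
        open Step S
        unchanged : Unchanged-on ω′ ω us
        unchanged = All.zipWith (λ (u≢u′ , (u′∈R , u′~v , _)) y →
                                   frame _ y (≢-sym u≢u′) (adj⇒≢ u′~v) (R≢p u∈R u′∈R))
                                (u∉us , earlier-us)
        tail≡2′ : All (λ u′ → ω′ u′ v ≡ 2) us
        tail≡2′ = All.zipWith (λ (e , u′v≡2) → trans (e v) u′v≡2) (unchanged , tail≡2)
        rest : Realises ω′ T
        rest = reach us unique earlier-us admissible′ tail≡2′ T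
                 (subst (λ d → _ ≤ T + d) (sym (drops-cong us unchanged)) lo′)
                 (subst (λ r → T ≤ _ + r) (sym (rises-cong us unchanged)) hi′)

      by-weight : ∀ w → ω u (p u) ≡ w → ws ω v ≤ T + (can-drop w + drops ω us) →
                  T ≤ ws ω v + (can-rise w + rises ω us) → Realises ω T
      by-weight 0 w≡0 _ _ = ⊥-elim (1+n≰n (subst (1 ≤_) w≡0 (≥1-at-p A u u∈R)))
      by-weight (suc (suc (suc w))) w≡3+ _ _ =
        ⊥-elim (1+n≰n (≤-trans (s≤s (s≤s (s≤s (z≤n {w})))) (subst (_≤ 2) w≡3+ (≤2-at-p A u u∈R))))
      by-weight 1 w≡1 lo hi with ws ω v ≤? T + drops ω us
      ... | yes lo′ = continue (no-step A) lo′ hi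
      ... | no ¬lo′ = continue step (≤-reflexive sum≡)
                        (subst (λ z → T ≤ z + rises ω us) (sym sum≡) (≤-trans (m≤m+n T _) (m≤m+n _ _)))
        where
        open Shift A u∈R v∈R u~v u<K v<K uv≡2 1 2 (cong (2 +_) (sym w≡1)) ≤-refl (s≤s z≤n) (s≤s z≤n) ≤-refl
        -- s(v) exceeds the target range by exactly one, so dropping by one lands in it.
        s≡ : ws ω v ≡ suc (T + drops ω us)
        s≡ = ≤-antisym (subst (ws ω v ≤_) (+-suc T _) lo) (≰⇒> ¬lo′)
        sum≡ : ws ω′ v ≡ T + drops ω us
        sum≡ = +-cancelʳ-≡ 2 _ _ (trans sum-at-v (trans (cong (_+ 1) s≡) (sym (+-suc (T + drops ω us) 1))))
      by-weight 2 w≡2 lo hi with T ≤? ws ω v + rises ω us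
      ... | yes hi′ = continue (no-step A) lo hi′
      ... | no ¬hi′ = continue step
                        (subst₂ (λ a b → a ≤ b + drops ω us) (sym sum≡) (sym T≡)
                           (s≤s (≤-trans (m≤m+n (ws ω v) (rises ω us)) (m≤m+n _ _))))
                        (≤-reflexive (trans T≡ (cong (_+ rises ω us) (sym sum≡))))
        where
        open Shift A u∈R v∈R u~v u<K v<K uv≡2 3 1 (cong (2 +_) (sym w≡2)) (s≤s z≤n) ≤-refl ≤-refl (s≤s z≤n)
        -- The target lies exactly one above the range, so rising by one reaches it.
        T≡ : T ≡ suc (ws ω v + rises ω us)
        T≡ = ≤-antisym (subst (T ≤_) (+-suc (ws ω v) _) hi) (≰⇒> ¬hi′)
        sum≡ : ws ω′ v ≡ suc (ws ω v)
        sum≡ = +-cancelʳ-≡ 2 _ _ (trans sum-at-v (+-suc (ws ω v) 2))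

  -- The invariant after stage k: ω is admissible for k and its sums already
  -- separate every edge between R-vertices of index < k, and every edge from such
  -- a vertex to I (whose sums can never exceed twice the degree).
  record Separating (k : ℕ) (ω : Weights n) : Set where
    field
      admissible    : Admissible k ω
      distinct-on-R : ∀ u w → I u ≡ false → I w ≡ false → toℕ u < k → toℕ w < k →
                      adj G u w ≡ true → ws ω u ≢ ws ω w
      above-I       : ∀ u x → I u ≡ false → toℕ u < k → I x ≡ true → adj G u x ≡ true →
                      2 * deg G x < ws ω u
  open Separating

  separating-start : Separating 0 (λ _ _ → 2)
  separating-start = record
    { admissible    = record
        { symmetric = λ _ _ → refl ; ≥1 = λ _ _ _ → s≤s z≤n ; ≤3 = λ _ _ _ → s≤s (s≤s z≤n)
        ; light-at-I = λ _ _ _ _ → ≤-refl ; fresh = λ _ _ _ _ _ → refl }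
    ; distinct-on-R = λ _ _ _ _ ()
    ; above-I       = λ _ _ _ () }

  module Stage (k : ℕ) (k<n : k < n) where

    v : Fin n
    v = fromℕ< k<n

    toℕ-v : toℕ v ≡ k
    toℕ-v = toℕ-fromℕ< k<n

    below-v : ∀ {u} → toℕ u < k → u ≢ v
    below-v u<k refl = <⇒≢ u<k toℕ-v

    handled : ∀ {u} → toℕ u < suc k → toℕ u < k ⊎ u ≡ v
    handled u<1+k with m<1+n⇒m<n∨m≡n u<1+k
    ... | inj₁ u<k = inj₁ u<k
    ... | inj₂ u≡k = inj₂ (toℕ-injective (trans u≡k (sym toℕ-v)))

    extend-at-I : I v ≡ true → ∀ {ω} → Separating k ω → Separating (suc k) ω
    extend-at-I v∈I {ω} S = record
      { admissible    = admissible-suc (admissible S)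
      ; distinct-on-R = λ u w u∈R w∈R u<1+k w<1+k → distinct u∈R w∈R (handled u<1+k) (handled w<1+k)
      ; above-I       = λ u x u∈R u<1+k → above u∈R (handled u<1+k) }
      where
      distinct : ∀ {u w} → I u ≡ false → I w ≡ false → toℕ u < k ⊎ u ≡ v → toℕ w < k ⊎ w ≡ v →
                 adj G u w ≡ true → ws ω u ≢ ws ω w
      distinct u∈R w∈R (inj₁ u<k) (inj₁ w<k) = distinct-on-R S _ _ u∈R w∈R u<k w<k
      distinct u∈R _   (inj₂ refl) _         = ⊥-elim (I≢R v∈I u∈R refl)
      distinct _   w∈R _           (inj₂ refl) = ⊥-elim (I≢R v∈I w∈R refl)
      above : ∀ {u x} → I u ≡ false → toℕ u < k ⊎ u ≡ v → I x ≡ true → adj G u x ≡ true →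
              2 * deg G x < ws ω u
      above u∈R (inj₁ u<k)  = above-I S _ _ u∈R u<k
      above u∈R (inj₂ refl) = ⊥-elim (I≢R v∈I u∈R refl)

    earlier : List (Fin n)
    earlier = filter (λ u → toℕ u <? k) (filter (λ u → T? (adj G v u ∧ not (I u))) (allFin n))

    earlier-unique : Unique earlier
    earlier-unique = Unique.filter⁺ (λ u → toℕ u <? k) (Unique.filter⁺ _ (Unique.allFin⁺ n))

    earlier-length : length earlier ≤ degIn G (compl I) v
    earlier-length = length-filter (λ u → toℕ u <? k) (filter (λ u → T? (adj G v u ∧ not (I u))) (allFin n))

    earlier-sound : ∀ {u} → u ∈ earlier → I u ≡ false × adj G v u ≡ true × toℕ u < k
    earlier-sound u∈ with ∈-filter⁻ (λ u → toℕ u <? k) u∈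
    ... | u∈′ , u<k with ∈-filter⁻ (λ u → T? (adj G v u ∧ not (I u))) {xs = allFin n} u∈′
    ... | _ , vu∧u∈R = Equivalence.to T-not-≡ (proj₂ (Equivalence.to T-∧ vu∧u∈R)) ,
                       Equivalence.to T-≡ (proj₁ (Equivalence.to T-∧ vu∧u∈R)) , u<k

    earlier-complete : ∀ {u} → I u ≡ false → adj G v u ≡ true → toℕ u < k → u ∈ earlier
    earlier-complete u∈R vu u<k = ∈-filter⁺ (λ u → toℕ u <? k)
      (∈-filter⁺ (λ u → T? (adj G v u ∧ not (I u))) (∈-allFin _)
        (Equivalence.from T-∧ (Equivalence.from T-≡ vu , Equivalence.from T-not-≡ u∈R))) u<k

    -- An R-vertex v: its sum is still s = 2 d(v). Through its earlier neighbours it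
    -- can be moved anywhere in [s - drops, s + rises], an interval of length
    -- |earlier|; pick a value t there missed by all their sums and realise it.
    -- Every value from s - drops on is above 2 d(x) for x ∈ I, by degree-gap.
    module At-R (v∈R : I v ≡ false) {ω : Weights n} (S : Separating k ω) where

      A : Admissible k ω
      A = admissible S

      open Reach (suc k) v∈R (≤-reflexive (cong suc toℕ-v))

      s d r : ℕ
      s = ws ω v
      d = drops ω earlier
      r = rises ω earlier

      s≡ : s ≡ 2 * deg G v
      s≡ = ws-≡ {ω = ω} (λ y vy → fresh A v y v∈R (≤-reflexive (sym toℕ-v)) vy)

      d≤dR : d ≤ degIn G (compl I) v
      d≤dR = ≤-trans (m≤m+n d r) (≤-trans (≤-reflexive (drops+rises ω earlier)) earlier-length)

      -- The room needed to stay above every I-neighbour after all possible drops.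
      room : ∀ x → I x ≡ true → adj G v x ≡ true → suc (2 * deg G x) + d ≤ s
      room x x∈I vx = begin
        suc (2 * deg G x) + d                      ≤⟨ +-monoʳ-≤ (suc (2 * deg G x)) d≤dR ⟩
        suc (2 * deg G x) + degIn G (compl I) v    ≡⟨ +-comm 1 (2 * deg G x + degIn G (compl I) v) ⟩
        2 * deg G x + degIn G (compl I) v + 1      ≤⟨ degree-gap x v x∈I v∈R vx ⟩
        2 * deg G v                                ≡⟨ s≡ ⟨
        s                                          ∎
        where open ≤-Reasoning

      d≤s : d ≤ s
      d≤s = ≤-trans (m≤n+m d _) (room (p v) (p∈I v v∈R) (u~p v v∈R))

      target : Σ ℕ λ t → s ∸ d ≤ t × t ≤ s ∸ d + length earlier × t ∉ map (ws ω) earlier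
      target = avoid (length earlier) (map (ws ω) earlier) (≤-reflexive (length-map (ws ω) earlier)) (s ∸ d)

      t : ℕ
      t = proj₁ target

      s-d≤t : s ∸ d ≤ t
      s-d≤t = proj₁ (proj₂ target)

      t-lower : s ≤ t + d
      t-lower = subst (_≤ t + d) (m∸n+n≡m d≤s) (+-monoˡ-≤ d s-d≤t)

      t-upper : t ≤ s + r
      t-upper = ≤-trans (proj₁ (proj₂ (proj₂ target))) (≤-reflexive (begin
        s ∸ d + length earlier  ≡⟨ cong (s ∸ d +_) (drops+rises ω earlier) ⟨
        s ∸ d + (d + r)         ≡⟨ +-assoc (s ∸ d) d r ⟨
        s ∸ d + d + r           ≡⟨ cong (_+ r) (m∸n+n≡m d≤s) ⟩
        s + r                   ∎))
        where open ≡-Reasoning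

      earlier-earlier : All Earlier earlier
      earlier-earlier = All.tabulate λ {u} u∈ → let (u∈R , vu , u<k) = earlier-sound u∈ in
        u∈R , trans (adj-sym G u v) vu , ≤-trans u<k (n≤1+n k)

      earlier≡2 : All (λ u → ω u v ≡ 2) earlier
      earlier≡2 = All.tabulate λ {u} u∈ →
        trans (symmetric A u v) (fresh A v u v∈R (≤-reflexive (sym toℕ-v)) (proj₁ (proj₂ (earlier-sound u∈))))

      open Realises (reach earlier earlier-unique earlier-earlier (admissible-suc A) earlier≡2 t t-lower t-upper)
        public

      new-vs-earlier : ∀ {w} → I w ≡ false → adj G v w ≡ true → toℕ w < k → ws ω′ v ≢ ws ω′ w
      new-vs-earlier w∈R vw w<k sv≡sw = proj₂ (proj₂ (proj₂ target)) (subst (_∈ map (ws ω) earlier)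
        (trans (sym (ω′-keeps-R _ w∈R (below-v w<k))) (trans (sym sv≡sw) ω′-at-v))
        (∈-map⁺ (ws ω) (earlier-complete w∈R vw w<k)))

      distinct : ∀ {u w} → I u ≡ false → I w ≡ false → toℕ u < k ⊎ u ≡ v → toℕ w < k ⊎ w ≡ v →
                 adj G u w ≡ true → ws ω′ u ≢ ws ω′ w
      distinct u∈R w∈R (inj₁ u<k) (inj₁ w<k) uw su≡sw = distinct-on-R S _ _ u∈R w∈R u<k w<k uw
        (trans (sym (ω′-keeps-R _ u∈R (below-v u<k))) (trans su≡sw (ω′-keeps-R _ w∈R (below-v w<k))))
      distinct _   w∈R (inj₂ refl) (inj₁ w<k)  vw = new-vs-earlier w∈R vw w<k
      distinct u∈R _   (inj₁ u<k)  (inj₂ refl) uv = new-vs-earlier u∈R (trans (adj-sym G v _) uv) u<k ∘ sym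
      distinct _   _   (inj₂ refl) (inj₂ refl) vv = ⊥-elim (adj⇒≢ vv refl)

      above : ∀ {u x} → I u ≡ false → toℕ u < k ⊎ u ≡ v → I x ≡ true → adj G u x ≡ true →
              2 * deg G x < ws ω′ u
      above u∈R (inj₁ u<k)  x∈I ux = subst (2 * deg G _ <_) (sym (ω′-keeps-R _ u∈R (below-v u<k)))
                                       (above-I S _ _ u∈R u<k x∈I ux)
      above _   (inj₂ refl) x∈I vx = subst (2 * deg G _ <_) (sym ω′-at-v)
                                       (≤-trans (m+n≤o⇒m≤o∸n (suc (2 * deg G _)) (room _ x∈I vx)) s-d≤t)

      separating′ : Separating (suc k) ω′
      separating′ = record
        { admissible    = ω′-admissible
        ; distinct-on-R = λ u w u∈R w∈R u<1+k w<1+k → distinct u∈R w∈R (handled u<1+k) (handled w<1+k)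
        ; above-I       = λ u x u∈R u<1+k → above u∈R (handled u<1+k) }

  extend : ∀ k → k < n → ∀ {ω} → Separating k ω → Σ (Weights n) (Separating (suc k))
  extend k k<n {ω} S with I (Stage.v k k<n) in v∈?
  ... | true  = ω , Stage.extend-at-I k k<n v∈? S
  ... | false = At-R.ω′ v∈? S , At-R.separating′ v∈? S
    where open Stage k k<n using (module At-R)

  separating : ∀ k → k ≤ n → Σ (Weights n) (Separating k)
  separating zero    _   = (λ _ _ → 2) , separating-start
  separating (suc k) k<n = extend k k<n (proj₂ (separating k (<⇒≤ k<n)))

  -- After all n stages, a vertex of I has sum at most twice its degree, below the
  -- sum of each of its R-neighbours …
  R-above-I : ∀ {ω} → Separating n ω → ∀ {u x} → I u ≡ false → I x ≡ true → adj G u x ≡ true →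
              ws ω u ≢ ws ω x
  R-above-I {ω} S {u} {x} u∈R x∈I ux su≡sx = <⇒≱ (above-I S u x u∈R (toℕ<n u) x∈I ux)
    (≤-trans (≤-reflexive su≡sx) (ws-≤ {ω = ω} (λ y → light-at-I (admissible S) x y x∈I)))

  proper : ∀ {ω} → Separating n ω → ∀ u w → adj G u w ≡ true → ws ω u ≢ ws ω w
  proper S u w uw with I u in u∈? | I w in w∈?
  ... | true  | true  = ⊥-elim (true≢false (trans (sym uw) (independent u w u∈? w∈?)))
  ... | false | false = distinct-on-R S u w u∈? w∈? (toℕ<n u) (toℕ<n w) uw
  ... | false | true  = R-above-I S u∈? w∈? uw
  ... | true  | false = R-above-I S w∈? u∈? (trans (adj-sym G w u) uw) ∘ sym

  fulfills : Fulfills123 G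
  fulfills = fulfills-123 ω (symmetric A) (≥1 A) (≤3 A) (proper S)
    where
    ω : Weights n
    ω = proj₁ (separating n ≤-refl)
    S : Separating n ω
    S = proj₂ (separating n ≤-refl)
    A : Admissible n ω
    A = admissible S

open import Data.Bool.Properties using (T-≡; T-not-≡)
open import Function.Bundles using (Equivalence)
open import Function using (case_of_)
open import Data.Rational using (ℚ; _≤_; _+_; _*_; 1ℚ)

neighbour-in-I : ∀ {n} {G : Graph n} {I : Subset n} → MaximalIndependent G I →
                 Σ (Fin n → Fin n) λ p → ∀ u → I u ≡ false → I (p u) ≡ true × adj G u (p u) ≡ true
neighbour-in-I {n} {G} {I} (_ , dominated) = (λ u → choose u (I u) refl) , (λ u → choose-spec u (I u) refl)
  where
  choose : ∀ u b → I u ≡ b → Fin n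
  choose u true  _   = u
  choose u false u∈R = proj₁ (dominated u u∈R)
  choose-spec : ∀ u b (u∈? : I u ≡ b) → I u ≡ false →
                I (choose u b u∈?) ≡ true × adj G u (choose u b u∈?) ≡ true
  choose-spec u true  u∈I u∈R = case trans (sym u∈I) u∈R of λ ()
  choose-spec u false u∈R _   =
    Equivalence.to T-≡ (proj₁ (proj₂ (dominated u u∈R))) , proj₂ (proj₂ (dominated u u∈R))

lemma4 : ∀ {n} (G : Graph n) (I : Subset n) → MaximalIndependent G I →
         (α : ℚ) → 1ℚ ≤ α →
         (∀ v → T (I v) → ℕ→ℚ (deg G v) ≤ α) →
         (∀ v → T (compl I v) →
            ℕ→ℚ 2 * α + ℕ→ℚ (degIn G (compl I) v) + 1ℚ ≤ ℕ→ℚ 2 * ℕ→ℚ (deg G v)) →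
         Fulfills123 G
lemma4 {n} G I maximal α _ deg-I deg-R =
  Greedy.fulfills G I p (λ u u∈R → proj₁ (p-spec u u∈R)) (λ u u∈R → proj₂ (p-spec u u∈R))
    independent degree-gap
  where
  p : Fin n → Fin n
  p = proj₁ (neighbour-in-I {G = G} {I = I} maximal)
  p-spec : ∀ u → I u ≡ false → I (p u) ≡ true × adj G u (p u) ≡ true
  p-spec = proj₂ (neighbour-in-I {G = G} {I = I} maximal)
  -- The hypotheses in the form Greedy uses; degree-gap even holds for
  -- non-adjacent x ∈ I and v ∈ R.
  independent : ∀ x y → I x ≡ true → I y ≡ true → adj G x y ≡ false
  independent x y x∈I y∈I = proj₁ maximal x y (Equivalence.from T-≡ x∈I) (Equivalence.from T-≡ y∈I)
  degree-gap : ∀ x v → I x ≡ true → I v ≡ false → adj G v x ≡ true →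
               2 ℕ.* deg G x ℕ.+ degIn G (compl I) v ℕ.+ 1 ℕ.≤ 2 ℕ.* deg G v
  degree-gap x v x∈I v∈R _ = NatEmbedding.combine-degree-bounds (deg G x) (degIn G (compl I) v) (deg G v) α
    (deg-I x (Equivalence.from T-≡ x∈I)) (deg-R v (Equivalence.from T-not-≡ v∈R))
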